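{- Let $P$ be a finite set of players partitioned into $m$ disjoint subsets $P=P_1\cup\dots\cup P_m$, with $n_i=|P_i|$, and let $k_1<k_2<\dots<k_m$ be positive integers. Let $H$ be the disjunctive hierarchical game on $P$ with this partition and these thresholds, i.e. $X\subseteq P$ is winning iff there exists $i\in\{1,\dots,m\}$ with $|X\cap(P_1\cup\dots\cup P_i)|\ge k_i$. Then the equivalence relation $\sim_H$ has exactly $m$ equivalence classes (so that the canonical representation of $H$ is defined on the multiset $\{1^{n_1},\dots,m^{n_m}\}$) if and only if (a) $k_1\le n_1$, and (b) $k_i<k_{i-1}+n_i$ for every $1<i<m$. Suppose (a) and (b) hold. Then the sequence $(k_1,\dots,k_{m-1})$ is uniquely determined: if $k'_1<\dots<k'_m$ are positive integers such that the disjunctive hierarchical game on $P$ with the same partition and thresholds $k'_1,\dots,k'_m$ equals $H$, then $k'_i=k_i$ for all $1\le i\le m-1$. Moreover, $H$ has no dummy players if and only if $k_m<k_{m-1}+n_m$, and in this case $k_m$ is uniquely determined as well (i.e. also $k'_m=k_m$ for any such $k'$); if $k_m\ge k_{m-1}+n_m$, then every player of $P_m$ is a dummy.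
   Context: A simple game on a finite set $P$ is a pair $(P,W)$ where $W$ is a nonempty family of subsets of $P$ (the winning coalitions) such that $X\in W$ and $X\subseteq Y\subseteq P$ imply $Y\in W$; other coalitions are losing. A player is a dummy if it belongs to no minimal winning coalition. For a simple game $G$, the relation $\sim_G$ on $P$ is defined by $i\sim_G j$ iff for every $X\subseteq P$ containing neither $i$ nor $j$, $X\cup\{i\}\in W\iff X\cup\{j\}\in W$; it is an equivalence relation. If the equivalence classes have sizes $n_1,\dots,n_m$, the canonical representation of $G$ is the game on the multiset $\{1^{n_1},\dots,m^{n_m}\}$ in which a submultiset $\{1^{\ell_1},\dots,m^{\ell_m}\}$ is winning iff a coalition containing $\ell_i$ players from the $i$-th class for each $i$ is winning in $G$. -}

module Defs where

open import Data.Nat as ℕ using (ℕ; suc; _<_; _≤_; _+_)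
open import Data.Fin as Fin using (Fin; toℕ; fromℕ; inject₁)
open import Data.Fin.Subset using (Subset; _∈_; _∉_; _⊆_; _∩_; _∪_; ⁅_⁆; ∣_∣)
open import Data.Vec using (tabulate)
open import Data.Product using (Σ; ∃; _×_)
open import Relation.Nullary using (¬_)
open import Relation.Nullary.Decidable using (⌊_⌋)
open import Relation.Binary.PropositionalEquality using (_≡_)
open import Function.Bundles using (_⇔_)

Equiv : {N : ℕ} → (Subset N → Set) → Fin N → Fin N → Set
Equiv {N} W i j = (X : Subset N) → i ∉ X → j ∉ X → (W (X ∪ ⁅ i ⁆) ⇔ W (X ∪ ⁅ j ⁆))

HasExactlyClasses : {N : ℕ} → (Fin N → Fin N → Set) → ℕ → Set
HasExactlyClasses {N} R c =
  Σ (Fin N → Fin c) λ f →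
    ((y : Fin c) → ∃ λ p → f p ≡ y) × ((p q : Fin N) → (R p q ⇔ (f p ≡ f q)))

MinimalWinning : {N : ℕ} → (Subset N → Set) → Subset N → Set
MinimalWinning {N} W X = W X × ((Y : Subset N) → Y ⊆ X → W Y → X ⊆ Y)

Dummy : {N : ℕ} → (Subset N → Set) → Fin N → Set
Dummy {N} W p = (X : Subset N) → MinimalWinning W X → p ∉ X

-- Disjunctive hierarchical games.  The partition P = P_0 ∪ … ∪ P_{m-1}
-- (0-indexed) is given by part : Fin N → Fin m, with P_i = part⁻¹(i).

Level : {N m : ℕ} → (Fin N → Fin m) → Fin m → Subset N
Level part i = tabulate (λ p → ⌊ part p Fin.≟ i ⌋)

UpTo : {N m : ℕ} → (Fin N → Fin m) → Fin m → Subset N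
UpTo part i = tabulate (λ p → ⌊ part p Fin.≤? i ⌋)

size : {N m : ℕ} → (Fin N → Fin m) → Fin m → ℕ
size part i = ∣ Level part i ∣

DHWin : {N m : ℕ} → (Fin N → Fin m) → (Fin m → ℕ) → Subset N → Set
DHWin part k X = ∃ λ i → k i ≤ ∣ X ∩ UpTo part i ∣

Thresholds : {m : ℕ} → (Fin m → ℕ) → Set
Thresholds {m} k = ((i : Fin m) → 1 ≤ k i) × ((i j : Fin m) → i Fin.< j → k i < k j)

CondA : {N m : ℕ} → (Fin N → Fin (suc m)) → (Fin (suc m) → ℕ) → Set
CondA part k = k Fin.zero ≤ size part Fin.zero

-- condition (b): k_i < k_{i-1} + n_i for 1 < i < m (1-indexed),
-- i.e. for 0-indexed j with j = i + 1 and j + 1 < m.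
CondB : {N m : ℕ} → (Fin N → Fin m) → (Fin m → ℕ) → Set
CondB {N} {m} part k =
  (i j : Fin m) → toℕ j ≡ suc (toℕ i) → suc (toℕ j) < m → k j < k i + size part j

lastL : (m₀ : ℕ) → Fin (suc (suc m₀))
lastL m₀ = fromℕ (suc m₀)

penL : (m₀ : ℕ) → Fin (suc (suc m₀))
penL m₀ = inject₁ (fromℕ m₀)

-- Call a coalition tight at level i if it has exactly k_j − 1 players in P_0 ∪ … ∪ P_j for
-- every j < i.  A tight coalition cannot win through a lower tier, so it wins iff |X| ≥ k_i,
-- and tight coalitions of every size from k_{i-1} − 1 to k_{i-1} − 1 + n_i exist as long as
-- every level up to i is effective: k_j ≤ k_{j-1} − 1 + n_j.  Tight coalitions of suitable
-- sizes pin down each k_i, separate a player from every higher-level player, and put every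
-- player into a minimal winning coalition.  If level j is not effective, reaching k_j in
-- tier j already reaches k_{j-1} in tier j − 1, so tier j never matters: levels j and j + 1
-- merge, and at the top level every player is a dummy.

module Submission where

open import Data.Bool using (true; false)
open import Data.Bool.Properties using (T-≡)
open import Data.Fin as Fin using (Fin; toℕ; inject₁; punchOut)
open import Data.Fin.Induction using (<-weakInduction; <-wellFounded)
open import Data.Fin.Properties
  using (toℕ-injective; toℕ-inject₁; toℕ-fromℕ; toℕ-fromℕ<; toℕ<n; ≤fromℕ; ≤̄⇒inject₁<;
         any?; pigeonhole; punchOut-injective)
open import Data.Fin.Subset
open import Data.Fin.Subset.Properties
open import Data.Nat as ℕ using (ℕ; zero; suc; _<_; _≤_; _+_; _∸_; z≤n; s≤s)
open import Data.Nat.Properties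
open import Data.Product using (∃; _×_; _,_; proj₁; proj₂)
open import Data.Sum using (inj₁; inj₂)
open import Data.Vec using ([]; _∷_; here; there; tabulate)
open import Data.Vec.Properties using (lookup∘tabulate; []=⇒lookup; lookup⇒[]=)
open import Function using (_∘_)
open import Function.Bundles using (_⇔_; mk⇔; Equivalence)
import Function.Properties.Equivalence as ⇔
open import Induction.WellFounded using (WfRec; module All)
open import Level using (0ℓ)
open import Relation.Binary.Definitions using (tri<; tri≈; tri>)
open import Relation.Binary.PropositionalEquality
open import Relation.Nullary using (¬_; yes; no; contradiction)
open import Relation.Nullary.Decidable using (⌊_⌋; toWitness; fromWitness)
open import Relation.Unary using (Pred; Decidable)

open import Defs

open Equivalence using (to; from)

∣p∪q∣+∣p∩q∣≡∣p∣+∣q∣ : ∀ {n} (p q : Subset n) → ∣ p ∪ q ∣ + ∣ p ∩ q ∣ ≡ ∣ p ∣ + ∣ q ∣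
∣p∪q∣+∣p∩q∣≡∣p∣+∣q∣ [] [] = refl
∣p∪q∣+∣p∩q∣≡∣p∣+∣q∣ (true ∷ p) (true ∷ q) =
  cong suc (trans (+-suc _ _) (trans (cong suc (∣p∪q∣+∣p∩q∣≡∣p∣+∣q∣ p q)) (sym (+-suc _ _))))
∣p∪q∣+∣p∩q∣≡∣p∣+∣q∣ (true ∷ p) (false ∷ q) = cong suc (∣p∪q∣+∣p∩q∣≡∣p∣+∣q∣ p q)
∣p∪q∣+∣p∩q∣≡∣p∣+∣q∣ (false ∷ p) (true ∷ q) = trans (cong suc (∣p∪q∣+∣p∩q∣≡∣p∣+∣q∣ p q)) (sym (+-suc _ _))
∣p∪q∣+∣p∩q∣≡∣p∣+∣q∣ (false ∷ p) (false ∷ q) = ∣p∪q∣+∣p∩q∣≡∣p∣+∣q∣ p q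

∣p∪q∣≤∣p∣+∣q∣ : ∀ {n} (p q : Subset n) → ∣ p ∪ q ∣ ≤ ∣ p ∣ + ∣ q ∣
∣p∪q∣≤∣p∣+∣q∣ p q = subst (∣ p ∪ q ∣ ≤_) (∣p∪q∣+∣p∩q∣≡∣p∣+∣q∣ p q) (m≤m+n _ _)

disjoint⇒∣p∪q∣≡∣p∣+∣q∣ : ∀ {n} (p q : Subset n) → (∀ {x} → x ∈ p → x ∉ q) → ∣ p ∪ q ∣ ≡ ∣ p ∣ + ∣ q ∣
disjoint⇒∣p∪q∣≡∣p∣+∣q∣ {n} p q disjoint = begin
  ∣ p ∪ q ∣                 ≡⟨ +-identityʳ _ ⟨
  ∣ p ∪ q ∣ + 0             ≡⟨ cong (∣ p ∪ q ∣ +_) (∣⊥∣≡0 n) ⟨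
  ∣ p ∪ q ∣ + ∣ ⊥ {n} ∣     ≡⟨ cong (λ r → ∣ p ∪ q ∣ + ∣ r ∣) p∩q≡⊥ ⟨
  ∣ p ∪ q ∣ + ∣ p ∩ q ∣     ≡⟨ ∣p∪q∣+∣p∩q∣≡∣p∣+∣q∣ p q ⟩
  ∣ p ∣ + ∣ q ∣             ∎
  where
  open ≡-Reasoning
  p∩q≡⊥ : p ∩ q ≡ ⊥
  p∩q≡⊥ = Empty-unique λ (x , x∈p∩q) → let (x∈p , x∈q) = x∈p∩q⁻ p q x∈p∩q in disjoint x∈p x∈q

p⊆q⇒p∩q≡p : ∀ {n} {p q : Subset n} → p ⊆ q → p ∩ q ≡ p
p⊆q⇒p∩q≡p {p = p} {q} p⊆q = ⊆-antisym (p∩q⊆p p q) (λ x∈p → x∈p∩q⁺ (x∈p , p⊆q x∈p))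

p⊆q∧∣q∣≤∣p∣⇒q⊆p : ∀ {n} {p q : Subset n} → p ⊆ q → ∣ q ∣ ≤ ∣ p ∣ → q ⊆ p
p⊆q∧∣q∣≤∣p∣⇒q⊆p {p = []} {[]} _ _ ()
p⊆q∧∣q∣≤∣p∣⇒q⊆p {p = true ∷ p} {true ∷ q} p⊆q ∣q∣≤∣p∣ =
  in⊆in (p⊆q∧∣q∣≤∣p∣⇒q⊆p (drop-∷-⊆ p⊆q) (ℕ.s≤s⁻¹ ∣q∣≤∣p∣))
p⊆q∧∣q∣≤∣p∣⇒q⊆p {p = false ∷ p} {true ∷ q} p⊆q ∣q∣≤∣p∣ =
  contradiction (≤-trans ∣q∣≤∣p∣ (p⊆q⇒∣p∣≤∣q∣ (drop-∷-⊆ p⊆q))) (<-irrefl refl)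
p⊆q∧∣q∣≤∣p∣⇒q⊆p {p = true ∷ p} {false ∷ q} p⊆q _ with () ← p⊆q here
p⊆q∧∣q∣≤∣p∣⇒q⊆p {p = false ∷ p} {false ∷ q} p⊆q ∣q∣≤∣p∣ =
  out⊆ (p⊆q∧∣q∣≤∣p∣⇒q⊆p (drop-∷-⊆ p⊆q) ∣q∣≤∣p∣)

subset-of-size : ∀ {n} (p : Subset n) t → t ≤ ∣ p ∣ → ∃ λ q → q ⊆ p × ∣ q ∣ ≡ t
subset-of-size {n} p zero _ = ⊥ , (λ x∈⊥ → contradiction x∈⊥ ∉⊥) , ∣⊥∣≡0 n
subset-of-size (true ∷ p) (suc t) t<∣p∣ with q , q⊆p , ∣q∣≡t ← subset-of-size p t (ℕ.s≤s⁻¹ t<∣p∣) =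
  true ∷ q , in⊆in q⊆p , cong suc ∣q∣≡t
subset-of-size (false ∷ p) (suc t) t<∣p∣ with q , q⊆p , ∣q∣≡t ← subset-of-size p (suc t) t<∣p∣ =
  false ∷ q , out⊆ q⊆p , ∣q∣≡t

x∉p-x : ∀ {n} (p : Subset n) x → x ∉ p - x
x∉p-x (_ ∷ p) (Fin.suc x) (there x∈p-x) = x∉p-x p x x∈p-x

x∈p⇒suc∣p-x∣≡∣p∣ : ∀ {n} {p : Subset n} {x} → x ∈ p → suc ∣ p - x ∣ ≡ ∣ p ∣
x∈p⇒suc∣p-x∣≡∣p∣ {p = true ∷ p} here = cong (suc ∘ ∣_∣) (p─⊥≡p p)
x∈p⇒suc∣p-x∣≡∣p∣ {p = true ∷ p} (there x∈p) = cong suc (x∈p⇒suc∣p-x∣≡∣p∣ x∈p)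
x∈p⇒suc∣p-x∣≡∣p∣ {p = false ∷ p} (there x∈p) = x∈p⇒suc∣p-x∣≡∣p∣ x∈p

disjoint⇒[p∪q]∩r≡p∩r : ∀ {n} (p q r : Subset n) → (∀ {x} → x ∈ q → x ∉ r) → (p ∪ q) ∩ r ≡ p ∩ r
disjoint⇒[p∪q]∩r≡p∩r p q r disjoint = begin
  (p ∪ q) ∩ r      ≡⟨ ∩-distribʳ-∪ r p q ⟩
  p ∩ r ∪ q ∩ r    ≡⟨ cong (p ∩ r ∪_) q∩r≡⊥ ⟩
  p ∩ r ∪ ⊥        ≡⟨ ∪-identityʳ (p ∩ r) ⟩
  p ∩ r            ∎
  where
  open ≡-Reasoning
  q∩r≡⊥ : q ∩ r ≡ ⊥
  q∩r≡⊥ = Empty-unique λ (x , x∈q∩r) → let (x∈q , x∈r) = x∈p∩q⁻ q r x∈q∩r in disjoint x∈q x∈r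

x∉q⇒[p∪⁅x⁆]∩q≡p∩q : ∀ {n} (p q : Subset n) x → x ∉ q → (p ∪ ⁅ x ⁆) ∩ q ≡ p ∩ q
x∉q⇒[p∪⁅x⁆]∩q≡p∩q p q x x∉q =
  disjoint⇒[p∪q]∩r≡p∩r p ⁅ x ⁆ q λ y∈⁅x⁆ → subst (_∉ q) (sym (x∈⁅y⁆⇒x≡y x y∈⁅x⁆)) x∉q

x∉p⇒∣p∪⁅x⁆∣≡suc∣p∣ : ∀ {n} {p : Subset n} {x} → x ∉ p → ∣ p ∪ ⁅ x ⁆ ∣ ≡ suc ∣ p ∣
x∉p⇒∣p∪⁅x⁆∣≡suc∣p∣ {p = p} {x} x∉p = begin
  ∣ p ∪ ⁅ x ⁆ ∣          ≡⟨ disjoint⇒∣p∪q∣≡∣p∣+∣q∣ p ⁅ x ⁆ disjoint ⟩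
  ∣ p ∣ + ∣ ⁅ x ⁆ ∣      ≡⟨ cong (∣ p ∣ +_) (∣⁅x⁆∣≡1 x) ⟩
  ∣ p ∣ + 1              ≡⟨ +-comm _ 1 ⟩
  suc ∣ p ∣              ∎
  where
  open ≡-Reasoning
  disjoint : ∀ {y} → y ∈ p → y ∉ ⁅ x ⁆
  disjoint y∈p y∈⁅x⁆ rewrite x∈⁅y⁆⇒x≡y x y∈⁅x⁆ = x∉p y∈p

module _ {n : ℕ} (p q : Subset n) (x : Fin n) where

  private
    split : (p ∪ ⁅ x ⁆) ∩ q ≡ p ∩ q ∪ ⁅ x ⁆ ∩ q
    split = ∩-distribʳ-∪ q p ⁅ x ⁆

  ∣[p∪⁅x⁆]∩q∣≤suc∣p∩q∣ : ∣ (p ∪ ⁅ x ⁆) ∩ q ∣ ≤ suc ∣ p ∩ q ∣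
  ∣[p∪⁅x⁆]∩q∣≤suc∣p∩q∣ = begin
    ∣ (p ∪ ⁅ x ⁆) ∩ q ∣        ≡⟨ cong ∣_∣ split ⟩
    ∣ p ∩ q ∪ ⁅ x ⁆ ∩ q ∣      ≤⟨ ∣p∪q∣≤∣p∣+∣q∣ (p ∩ q) (⁅ x ⁆ ∩ q) ⟩
    ∣ p ∩ q ∣ + ∣ ⁅ x ⁆ ∩ q ∣  ≤⟨ +-monoʳ-≤ ∣ p ∩ q ∣ (∣p∩q∣≤∣p∣ ⁅ x ⁆ q) ⟩
    ∣ p ∩ q ∣ + ∣ ⁅ x ⁆ ∣      ≡⟨ cong (∣ p ∩ q ∣ +_) (∣⁅x⁆∣≡1 x) ⟩
    ∣ p ∩ q ∣ + 1              ≡⟨ +-comm _ 1 ⟩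
    suc ∣ p ∩ q ∣              ∎
    where open ≤-Reasoning

  x∉p∧x∈q⇒∣[p∪⁅x⁆]∩q∣≡suc∣p∩q∣ : x ∉ p → x ∈ q → ∣ (p ∪ ⁅ x ⁆) ∩ q ∣ ≡ suc ∣ p ∩ q ∣
  x∉p∧x∈q⇒∣[p∪⁅x⁆]∩q∣≡suc∣p∩q∣ x∉p x∈q = begin
    ∣ (p ∪ ⁅ x ⁆) ∩ q ∣        ≡⟨ cong ∣_∣ split ⟩
    ∣ p ∩ q ∪ ⁅ x ⁆ ∩ q ∣      ≡⟨ cong (λ r → ∣ p ∩ q ∪ r ∣) (p⊆q⇒p∩q≡p ⁅x⁆⊆q) ⟩
    ∣ p ∩ q ∪ ⁅ x ⁆ ∣          ≡⟨ x∉p⇒∣p∪⁅x⁆∣≡suc∣p∣ (x∉p ∘ p∩q⊆p p q) ⟩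
    suc ∣ p ∩ q ∣              ∎
    where
    open ≡-Reasoning
    ⁅x⁆⊆q : ⁅ x ⁆ ⊆ q
    ⁅x⁆⊆q y∈⁅x⁆ rewrite x∈⁅y⁆⇒x≡y x y∈⁅x⁆ = x∈q

  x∉q⇒p∩q⊆[p-x]∩q : x ∉ q → p ∩ q ⊆ (p - x) ∩ q
  x∉q⇒p∩q⊆[p-x]∩q x∉q y∈p∩q with y∈p , y∈q ← x∈p∩q⁻ p q y∈p∩q =
    x∈p∩q⁺ (x∈p∧x≢y⇒x∈p-y y∈p (λ { refl → x∉q y∈q }) , y∈q)

p⊆q⇒∣p∩r∣≤∣q∩r∣ : ∀ {n} {p q : Subset n} → p ⊆ q → ∀ r → ∣ p ∩ r ∣ ≤ ∣ q ∩ r ∣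
p⊆q⇒∣p∩r∣≤∣q∩r∣ {p = p} p⊆q r = p⊆q⇒∣p∣≤∣q∣ λ x∈p∩r →
  let (x∈p , x∈r) = x∈p∩q⁻ p r x∈p∩r in x∈p∩q⁺ (p⊆q x∈p , x∈r)

x∈tabulate⇔ : ∀ {n} {P : Pred (Fin n) 0ℓ} (P? : Decidable P) {x} → x ∈ tabulate (λ y → ⌊ P? y ⌋) ⇔ P x
x∈tabulate⇔ P? {x} = mk⇔
  (λ x∈ → toWitness (from T-≡ (trans (sym (lookup∘tabulate _ x)) ([]=⇒lookup x∈))))
  (λ Px → lookup⇒[]= x _ (trans (lookup∘tabulate _ x) (to T-≡ (fromWitness Px))))

inject₁<suc : ∀ {m} (i : Fin m) → inject₁ i Fin.< Fin.suc i
inject₁<suc i = ≤̄⇒inject₁< ≤-refl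

<suc⇒≤inject₁ : ∀ {m} {j : Fin (suc m)} {i : Fin m} → j Fin.< Fin.suc i → j Fin.≤ inject₁ i
<suc⇒≤inject₁ {i = i} j<1+i = subst (_ ≤_) (sym (toℕ-inject₁ i)) (ℕ.s≤s⁻¹ j<1+i)

injective⇒surjective : ∀ {m} (h : Fin m → Fin m) → (∀ {x y} → h x ≡ h y → x ≡ y) → ∀ c → ∃ λ y → h y ≡ c
injective⇒surjective {suc m} h h-injective c with any? (λ y → h y Fin.≟ c)
... | yes hit = hit
... | no miss =
  let (y₁ , y₂ , y₁<y₂ , same) = pigeonhole (n<1+n m) (λ y → punchOut (c≢h y))
  in contradiction (h-injective (punchOut-injective (c≢h y₁) (c≢h y₂) same))
       λ y₁≡y₂ → <-irrefl (cong toℕ y₁≡y₂) y₁<y₂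
  where
  c≢h : ∀ y → c ≢ h y
  c≢h y c≡hy = miss (y , sym c≡hy)

section⇒injective : ∀ {m} (g h : Fin m → Fin m) → (∀ y → g (h y) ≡ y) → ∀ {a b} → g a ≡ g b → a ≡ b
section⇒injective {m} g h g∘h≡id {a} {b} ga≡gb = begin
  a       ≡⟨ hy₁≡a ⟨
  h y₁    ≡⟨ cong h y₁≡y₂ ⟩
  h y₂    ≡⟨ hy₂≡b ⟩
  b       ∎
  where
  open ≡-Reasoning
  h-injective : ∀ {x y} → h x ≡ h y → x ≡ y
  h-injective {x} {y} hx≡hy = trans (sym (g∘h≡id x)) (trans (cong g hx≡hy) (g∘h≡id y))
  y₁ y₂ : Fin m
  y₁ = proj₁ (injective⇒surjective h h-injective a)
  y₂ = proj₁ (injective⇒surjective h h-injective b)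
  hy₁≡a : h y₁ ≡ a
  hy₁≡a = proj₂ (injective⇒surjective h h-injective a)
  hy₂≡b : h y₂ ≡ b
  hy₂≡b = proj₂ (injective⇒surjective h h-injective b)
  y₁≡y₂ : y₁ ≡ y₂
  y₁≡y₂ = begin
    y₁          ≡⟨ g∘h≡id y₁ ⟨
    g (h y₁)    ≡⟨ cong g hy₁≡a ⟩
    g a         ≡⟨ ga≡gb ⟩
    g b         ≡⟨ cong g hy₂≡b ⟨
    g (h y₂)    ≡⟨ g∘h≡id y₂ ⟩
    y₂          ∎

level-classes-separate : ∀ {N M} {W : Subset N → Set} (part : Fin N → Fin M) →
  (∀ i → ∃ λ p → part p ≡ i) → (∀ {p q} → part p ≡ part q → Equiv W p q) →
  HasExactlyClasses (Equiv W) M → ∀ {p q} → Equiv W p q → part p ≡ part q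
level-classes-separate {M = M} part part-onto level⇒Equiv (f , f-onto , f-classes) {p} {q} p∼q =
  section⇒injective g h g∘h≡id (begin
    g (part p)   ≡⟨ f≡g∘part p ⟨
    f p          ≡⟨ to (f-classes p q) p∼q ⟩
    f q          ≡⟨ f≡g∘part q ⟩
    g (part q)   ∎)
  where
  open ≡-Reasoning
  -- g sends a level to its class; it is onto because f is, hence injective.
  g : Fin M → Fin M
  g i = f (proj₁ (part-onto i))
  h : Fin M → Fin M
  h y = part (proj₁ (f-onto y))
  f≡g∘part : ∀ p → f p ≡ g (part p)
  f≡g∘part p = to (f-classes p _) (level⇒Equiv (sym (proj₂ (part-onto (part p)))))
  g∘h≡id : ∀ y → g (h y) ≡ y
  g∘h≡id y = trans (sym (f≡g∘part _)) (proj₂ (f-onto y))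

module Tiers {N M : ℕ} (part : Fin N → Fin (suc M)) where

  U : Fin (suc M) → Subset N
  U = UpTo part

  L : Fin (suc M) → Subset N
  L = Level part

  n : Fin (suc M) → ℕ
  n = size part

  ∈U⇔ : ∀ {x i} → x ∈ U i ⇔ part x Fin.≤ i
  ∈U⇔ {i = i} = x∈tabulate⇔ (λ y → part y Fin.≤? i)

  ∈L⇔ : ∀ {x i} → x ∈ L i ⇔ part x ≡ i
  ∈L⇔ {i = i} = x∈tabulate⇔ (λ y → part y Fin.≟ i)

  U-zero⊆L-zero : U Fin.zero ⊆ L Fin.zero
  U-zero⊆L-zero x∈U = from ∈L⇔ (toℕ-injective (n≤0⇒n≡0 (to ∈U⇔ x∈U)))

  U-suc⊆U-inject₁∪L-suc : ∀ i → U (Fin.suc i) ⊆ U (inject₁ i) ∪ L (Fin.suc i)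
  U-suc⊆U-inject₁∪L-suc i {x} x∈U with part x Fin.≟ Fin.suc i
  ... | yes x∈Lᵢ = x∈p∪q⁺ (inj₂ (from ∈L⇔ x∈Lᵢ))
  ... | no x∉Lᵢ  = x∈p∪q⁺ (inj₁ (from ∈U⇔ (<suc⇒≤inject₁ (≤∧≢⇒< (to ∈U⇔ x∈U) (x∉Lᵢ ∘ toℕ-injective)))))

  ∣X∩U-suc∣≤∣X∩U-inject₁∣+n-suc : ∀ X i → ∣ X ∩ U (Fin.suc i) ∣ ≤ ∣ X ∩ U (inject₁ i) ∣ + n (Fin.suc i)
  ∣X∩U-suc∣≤∣X∩U-inject₁∣+n-suc X i = begin
    ∣ X ∩ U (Fin.suc i) ∣                         ≤⟨ p⊆q⇒∣p∣≤∣q∣ split ⟩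
    ∣ X ∩ U (inject₁ i) ∪ L (Fin.suc i) ∣         ≤⟨ ∣p∪q∣≤∣p∣+∣q∣ (X ∩ U (inject₁ i)) (L (Fin.suc i)) ⟩
    ∣ X ∩ U (inject₁ i) ∣ + n (Fin.suc i)         ∎
    where
    open ≤-Reasoning
    split : X ∩ U (Fin.suc i) ⊆ X ∩ U (inject₁ i) ∪ L (Fin.suc i)
    split x∈X∩U with x∈X , x∈U ← x∈p∩q⁻ X _ x∈X∩U with x∈p∪q⁻ _ _ (U-suc⊆U-inject₁∪L-suc i x∈U)
    ... | inj₁ x∈U′ = x∈p∪q⁺ (inj₁ (x∈p∩q⁺ (x∈X , x∈U′)))
    ... | inj₂ x∈L = x∈p∪q⁺ (inj₂ x∈L)

  Thresholds⇒mono : ∀ {K : Fin (suc M) → ℕ} → Thresholds K → ∀ {i j} → i Fin.≤ j → K i ≤ K j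
  Thresholds⇒mono (_ , K-strict) {i} {j} i≤j with m≤n⇒m<n∨m≡n i≤j
  ... | inj₁ i<j = <⇒≤ (K-strict i j i<j)
  ... | inj₂ i≡j rewrite toℕ-injective {i = i} {j} i≡j = ≤-refl

  lower-dominates : ∀ K {p q X} → part p Fin.≤ part q → p ∉ X → q ∉ X →
    DHWin part K (X ∪ ⁅ q ⁆) → DHWin part K (X ∪ ⁅ p ⁆)
  lower-dominates K {p} {q} {X} p≤q p∉X q∉X (l , K≤) with q ∈? U l
  ... | yes q∈U = l , (begin
    K l                      ≤⟨ K≤ ⟩
    ∣ (X ∪ ⁅ q ⁆) ∩ U l ∣    ≡⟨ x∉p∧x∈q⇒∣[p∪⁅x⁆]∩q∣≡suc∣p∩q∣ X (U l) q q∉X q∈U ⟩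
    suc ∣ X ∩ U l ∣          ≡⟨ x∉p∧x∈q⇒∣[p∪⁅x⁆]∩q∣≡suc∣p∩q∣ X (U l) p p∉X p∈U ⟨
    ∣ (X ∪ ⁅ p ⁆) ∩ U l ∣    ∎)
    where
    open ≤-Reasoning
    p∈U : p ∈ U l
    p∈U = from ∈U⇔ (≤-trans p≤q (to ∈U⇔ q∈U))
  ... | no q∉U = l , (begin
    K l                      ≤⟨ K≤ ⟩
    ∣ (X ∪ ⁅ q ⁆) ∩ U l ∣    ≡⟨ cong ∣_∣ (x∉q⇒[p∪⁅x⁆]∩q≡p∩q X (U l) q q∉U) ⟩
    ∣ X ∩ U l ∣              ≤⟨ p⊆q⇒∣p∩r∣≤∣q∩r∣ (p⊆p∪q {p = X} ⁅ p ⁆) (U l) ⟩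
    ∣ (X ∪ ⁅ p ⁆) ∩ U l ∣    ∎)
    where open ≤-Reasoning

  same-level⇒Equiv : ∀ K {p q} → part p ≡ part q → Equiv (DHWin part K) p q
  same-level⇒Equiv K p≡q X p∉X q∉X =
    mk⇔ (lower-dominates K (≤-reflexive (cong toℕ (sym p≡q))) q∉X p∉X)
        (lower-dominates K (≤-reflexive (cong toℕ p≡q)) p∉X q∉X)

  Short : (Fin (suc M) → ℕ) → Fin (suc M) → Subset N → Set
  Short K i Y = ∀ j → j Fin.< i → ∣ Y ∩ U j ∣ < K j

  Short⇒wins⇒K≤∣Y∣ : ∀ {K} → Thresholds K → ∀ {i Y} → Short K i Y → DHWin part K Y → K i ≤ ∣ Y ∣
  Short⇒wins⇒K≤∣Y∣ {K} K-thr {i} {Y} short (l , K≤) with toℕ l ℕ.<? toℕ i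
  ... | yes l<i = contradiction K≤ (<⇒≱ (short l l<i))
  ... | no l≮i = begin
    K i             ≤⟨ Thresholds⇒mono K-thr (≮⇒≥ l≮i) ⟩
    K l             ≤⟨ K≤ ⟩
    ∣ Y ∩ U l ∣     ≤⟨ ∣p∩q∣≤∣p∣ Y (U l) ⟩
    ∣ Y ∣           ∎
    where open ≤-Reasoning

  module Game (k : Fin (suc M) → ℕ) (k-thr : Thresholds k) where

    base : Fin (suc M) → ℕ
    base Fin.zero = 0
    base (Fin.suc i) = ℕ.pred (k (inject₁ i))

    -- Level 0 is effective iff (a) holds, a middle level iff (b) holds at it, and the top
    -- level iff k_m < k_{m-1} + n_m (see Effective-suc⇔).
    Effective : Fin (suc M) → Set
    Effective i = k i ≤ base i + n i

    EffectiveBelow : Fin (suc M) → Set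
    EffectiveBelow i = ∀ j → j Fin.< i → Effective j

    EffectiveUpTo : Fin (suc M) → Set
    EffectiveUpTo i = ∀ j → j Fin.≤ i → Effective j

    suc-pred-k : ∀ i → suc (ℕ.pred (k i)) ≡ k i
    suc-pred-k i with k i | proj₁ k-thr i
    ... | suc _ | _ = refl

    base<k : ∀ i → base i < k i
    base<k Fin.zero = proj₁ k-thr Fin.zero
    base<k (Fin.suc i) = ≤-<-trans pred[n]≤n (proj₂ k-thr _ _ (inject₁<suc i))

    Effective-suc⇔ : ∀ i → Effective (Fin.suc i) ⇔ k (Fin.suc i) < k (inject₁ i) + n (Fin.suc i)
    Effective-suc⇔ i = mk⇔ (λ effective → subst (k (Fin.suc i) <_) eq (s≤s effective))
                          (λ k< → ℕ.s≤s⁻¹ (subst (k (Fin.suc i) <_) (sym eq) k<))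
      where
      eq : suc (ℕ.pred (k (inject₁ i)) + n (Fin.suc i)) ≡ k (inject₁ i) + n (Fin.suc i)
      eq = cong (_+ n (Fin.suc i)) (suc-pred-k (inject₁ i))

    LowerTight : Fin (suc M) → Subset N → Set
    LowerTight i X = ∀ j → j Fin.< i → suc ∣ X ∩ U j ∣ ≡ k j

    Base : Fin (suc M) → Subset N → Set
    Base i B = (∀ {x} → x ∈ B → part x Fin.< i) × LowerTight i B

    Tight : Fin (suc M) → Subset N → Set
    Tight i X = X ⊆ U i × LowerTight i X

    Tight⇒Short : ∀ {i X} → Tight i X → Short k i X
    Tight⇒Short (_ , tight) j j<i = ≤-reflexive (tight j j<i)

    Tight⇒wins⇔ : ∀ {K} → Thresholds K → ∀ {i X} → (∀ j → j Fin.< i → K j ≡ k j) → Tight i X →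
      DHWin part K X ⇔ K i ≤ ∣ X ∣
    Tight⇒wins⇔ {K} K-thr {i} {X} agree X-tight@(X⊆U , _) = mk⇔
      (Short⇒wins⇒K≤∣Y∣ K-thr {i} {X} λ j j<i →
        subst (∣ X ∩ U j ∣ <_) (sym (agree j j<i)) (Tight⇒Short X-tight j j<i))
      (λ K≤∣X∣ → i , subst (K i ≤_) (sym (cong ∣_∣ (p⊆q⇒p∩q≡p X⊆U))) K≤∣X∣)

    Tight⇒minimal : ∀ {i X} → Tight i X → ∣ X ∣ ≡ k i → MinimalWinning (DHWin part k) X
    Tight⇒minimal {i} {X} X-tight ∣X∣≡k =
      from (Tight⇒wins⇔ k-thr (λ _ _ → refl) X-tight) (≤-reflexive (sym ∣X∣≡k)) , minimal
      where
      minimal : ∀ Y → Y ⊆ X → DHWin part k Y → X ⊆ Y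
      minimal Y Y⊆X Y-wins = p⊆q∧∣q∣≤∣p∣⇒q⊆p Y⊆X (begin
        ∣ X ∣   ≡⟨ ∣X∣≡k ⟩
        k i     ≤⟨ Short⇒wins⇒K≤∣Y∣ k-thr {i} {Y} Y-short Y-wins ⟩
        ∣ Y ∣   ∎)
        where
        open ≤-Reasoning
        Y-short : Short k i Y
        Y-short j j<i = ≤-<-trans (p⊆q⇒∣p∩r∣≤∣q∩r∣ Y⊆X (U j)) (Tight⇒Short X-tight j j<i)

    Base∪Level⇒Tight : ∀ {i B S} → Base i B → S ⊆ L i → Tight i (B ∪ S) × ∣ B ∪ S ∣ ≡ ∣ B ∣ + ∣ S ∣
    Base∪Level⇒Tight {i} {B} {S} (B<i , B-tight) S⊆L =
      (B∪S⊆U , B∪S-tight) , disjoint⇒∣p∪q∣≡∣p∣+∣q∣ B S disjoint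
      where
      S-level : ∀ {x} → x ∈ S → part x ≡ i
      S-level x∈S = to ∈L⇔ (S⊆L x∈S)
      disjoint : ∀ {x} → x ∈ B → x ∉ S
      disjoint x∈B x∈S = <-irrefl (cong toℕ (S-level x∈S)) (B<i x∈B)
      B∪S⊆U : B ∪ S ⊆ U i
      B∪S⊆U x∈B∪S with x∈p∪q⁻ B S x∈B∪S
      ... | inj₁ x∈B = from ∈U⇔ (<⇒≤ (B<i x∈B))
      ... | inj₂ x∈S = from ∈U⇔ (≤-reflexive (cong toℕ (S-level x∈S)))
      B∪S-tight : LowerTight i (B ∪ S)
      B∪S-tight j j<i = trans (cong (suc ∘ ∣_∣) (disjoint⇒[p∪q]∩r≡p∩r B S (U j) S∉U)) (B-tight j j<i)
        where
        S∉U : ∀ {x} → x ∈ S → x ∉ U j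
        S∉U x∈S x∈U = <⇒≱ j<i (subst (_≤ toℕ j) (cong toℕ (S-level x∈S)) (to ∈U⇔ x∈U))

    Tight⇒Base-suc : ∀ {i X} → Tight (inject₁ i) X → ∣ X ∣ ≡ base (Fin.suc i) → Base (Fin.suc i) X
    Tight⇒Base-suc {i} {X} (X⊆U , X-tight) ∣X∣≡base = X<1+i , X-tight′
      where
      X<1+i : ∀ {x} → x ∈ X → part x Fin.< Fin.suc i
      X<1+i x∈X = ≤-<-trans (to ∈U⇔ (X⊆U x∈X)) (inject₁<suc i)
      X-tight′ : LowerTight (Fin.suc i) X
      X-tight′ j j<1+i with m≤n⇒m<n∨m≡n (<suc⇒≤inject₁ j<1+i)
      ... | inj₁ j<i = X-tight j j<i
      ... | inj₂ j≡i rewrite toℕ-injective {i = j} {inject₁ i} j≡i = begin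
        suc ∣ X ∩ U (inject₁ i) ∣      ≡⟨ cong (suc ∘ ∣_∣) (p⊆q⇒p∩q≡p X⊆U) ⟩
        suc ∣ X ∣                      ≡⟨ cong suc ∣X∣≡base ⟩
        suc (ℕ.pred (k (inject₁ i)))   ≡⟨ suc-pred-k (inject₁ i) ⟩
        k (inject₁ i)                  ∎
        where open ≡-Reasoning

    Tight∪Level⇒Tight : ∀ {i X p} → Tight i X → part p ≡ i → Tight i (X ∪ ⁅ p ⁆)
    Tight∪Level⇒Tight {i} {X} {p} (X⊆U , X-tight) p∈Lᵢ = X∪p⊆U , X∪p-tight
      where
      X∪p⊆U : X ∪ ⁅ p ⁆ ⊆ U i
      X∪p⊆U x∈X∪p with x∈p∪q⁻ X ⁅ p ⁆ x∈X∪p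
      ... | inj₁ x∈X = X⊆U x∈X
      ... | inj₂ x∈⁅p⁆ rewrite x∈⁅y⁆⇒x≡y p x∈⁅p⁆ = from ∈U⇔ (≤-reflexive (cong toℕ p∈Lᵢ))
      X∪p-tight : LowerTight i (X ∪ ⁅ p ⁆)
      X∪p-tight j j<i = trans (cong (suc ∘ ∣_∣) (x∉q⇒[p∪⁅x⁆]∩q≡p∩q X (U j) p p∉Uⱼ)) (X-tight j j<i)
        where
        p∉Uⱼ : p ∉ U j
        p∉Uⱼ p∈U = <⇒≱ j<i (subst (_≤ toℕ j) (cong toℕ p∈Lᵢ) (to ∈U⇔ p∈U))

    tight-subset : ∀ {i B A t} → Base i B → ∣ B ∣ ≡ base i → A ⊆ L i → base i ≤ t → t ≤ base i + ∣ A ∣ →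
      ∃ λ S → S ⊆ A × Tight i (B ∪ S) × ∣ B ∪ S ∣ ≡ t
    tight-subset {i} {B} {A} {t} B-base ∣B∣≡base A⊆L base≤t t≤base+∣A∣
      with S , S⊆A , ∣S∣≡t∸base ← subset-of-size A (t ∸ base i) (m≤n+o⇒m∸n≤o t (base i) t≤base+∣A∣)
      with B∪S-tight , ∣B∪S∣≡ ← Base∪Level⇒Tight B-base (A⊆L ∘ S⊆A) = S , S⊆A , B∪S-tight , (begin
        ∣ B ∪ S ∣                ≡⟨ ∣B∪S∣≡ ⟩
        ∣ B ∣ + ∣ S ∣            ≡⟨ cong₂ _+_ ∣B∣≡base ∣S∣≡t∸base ⟩
        base i + (t ∸ base i)    ≡⟨ m+[n∸m]≡n base≤t ⟩
        t                        ∎)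
      where open ≡-Reasoning

    -- Opaque, like separating-coalition below: otherwise with-abstractions over the coalitions
    -- constructed here unfold their definitions (here the well-founded recursion behind
    -- <-weakInduction), which makes type checking very slow.
    opaque
      base-exists : ∀ i → EffectiveBelow i → ∃ λ B → Base i B × ∣ B ∣ ≡ base i
      base-exists = <-weakInduction P P-zero P-suc
        where
        P : Pred (Fin (suc M)) 0ℓ
        P i = EffectiveBelow i → ∃ λ B → Base i B × ∣ B ∣ ≡ base i
        P-zero : P Fin.zero
        P-zero _ = ⊥ , ((λ x∈⊥ → contradiction x∈⊥ ∉⊥) , λ _ ()) , ∣⊥∣≡0 N
        P-suc : ∀ i → P (inject₁ i) → P (Fin.suc i)
        P-suc i IH effective
          with B , B-base , ∣B∣≡base ← IH (λ j j<i → effective j (<-trans j<i (inject₁<suc i)))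
          with S , _ , X-tight , ∣X∣≡base′ ← tight-subset B-base ∣B∣≡base ⊆-refl
                 (<⇒≤pred (base<k (inject₁ i))) (≤-trans pred[n]≤n (effective (inject₁ i) (inject₁<suc i)))
          = B ∪ S , Tight⇒Base-suc X-tight ∣X∣≡base′ , ∣X∣≡base′

    tight-of-size : ∀ {i t} → EffectiveBelow i → base i ≤ t → t ≤ base i + n i → ∃ λ X → Tight i X × ∣ X ∣ ≡ t
    tight-of-size {i} effective base≤t t≤base+n
      with B , B-base , ∣B∣≡base ← base-exists i effective
      with S , _ , X-tight , ∣X∣≡t ← tight-subset B-base ∣B∣≡base ⊆-refl base≤t t≤base+n
      = B ∪ S , X-tight , ∣X∣≡t

    pred-k≤base+∣L-p∣ : ∀ p → Effective (part p) → ℕ.pred (k (part p)) ≤ base (part p) + ∣ L (part p) - p ∣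
    pred-k≤base+∣L-p∣ p effective = pred-mono-≤ (begin
      k i                           ≤⟨ effective ⟩
      base i + n i                  ≡⟨ cong (base i +_) (x∈p⇒suc∣p-x∣≡∣p∣ (from ∈L⇔ refl)) ⟨
      base i + suc ∣ L i - p ∣       ≡⟨ +-suc (base i) _ ⟩
      suc (base i + ∣ L i - p ∣)     ∎)
      where
      open ≤-Reasoning
      i : Fin (suc M)
      i = part p

    tight-avoiding : ∀ p → EffectiveUpTo (part p) → ∃ λ X → Tight (part p) X × p ∉ X × suc ∣ X ∣ ≡ k (part p)
    tight-avoiding p effective
      with B , B-base@(B<i , _) , ∣B∣≡base ← base-exists (part p) (λ j j<i → effective j (<⇒≤ j<i))
      with S , S⊆L-p , X-tight , ∣X∣≡pred-k ← tight-subset B-base ∣B∣≡base (p─q⊆p (L (part p)) ⁅ p ⁆)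
             (<⇒≤pred (base<k (part p))) (pred-k≤base+∣L-p∣ p (effective (part p) ≤-refl))
      = B ∪ S , X-tight , p∉B∪S , trans (cong suc ∣X∣≡pred-k) (suc-pred-k (part p))
      where
      p∉B∪S : p ∉ B ∪ S
      p∉B∪S p∈B∪S with x∈p∪q⁻ B S p∈B∪S
      ... | inj₁ p∈B = <-irrefl refl (B<i p∈B)
      ... | inj₂ p∈S = x∉p-x (L (part p)) p (S⊆L-p p∈S)

    Tight∧∣X∣<k⇒∣X∩U∣<k : ∀ {i X} → Tight i X → ∣ X ∣ < k i → ∀ j → ∣ X ∩ U j ∣ < k j
    Tight∧∣X∣<k⇒∣X∩U∣<k {i} {X} X-tight ∣X∣<k j with toℕ j ℕ.<? toℕ i
    ... | yes j<i = Tight⇒Short X-tight j j<i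
    ... | no j≮i = begin-strict
      ∣ X ∩ U j ∣   ≤⟨ ∣p∩q∣≤∣p∣ X (U j) ⟩
      ∣ X ∣         <⟨ ∣X∣<k ⟩
      k i           ≤⟨ Thresholds⇒mono k-thr (≮⇒≥ j≮i) ⟩
      k j           ∎
      where open ≤-Reasoning

    SameGame : (Fin (suc M) → ℕ) → Set
    SameGame K = ∀ X → DHWin part K X ⇔ DHWin part k X

    base≤K : ∀ {K} → Thresholds K → ∀ {i} → (∀ j → j Fin.< i → K j ≡ k j) → base i ≤ K i
    base≤K K-thr {Fin.zero} _ = z≤n
    base≤K {K} K-thr {Fin.suc i} agree = begin
      ℕ.pred (k (inject₁ i))   ≤⟨ pred[n]≤n ⟩
      k (inject₁ i)            ≡⟨ agree _ (inject₁<suc i) ⟨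
      K (inject₁ i)            ≤⟨ <⇒≤ (proj₂ K-thr _ _ (inject₁<suc i)) ⟩
      K (Fin.suc i)            ∎
      where open ≤-Reasoning

    threshold-agrees : ∀ {K} → Thresholds K → SameGame K → ∀ {i} → EffectiveUpTo i →
      (∀ j → j Fin.< i → K j ≡ k j) → K i ≡ k i
    threshold-agrees {K} K-thr same {i} effective agree = ≤-antisym K≤k k≤K
      where
      effective-below : EffectiveBelow i
      effective-below j j<i = effective j (<⇒≤ j<i)
      K⇔k : ∀ {X} → Tight i X → K i ≤ ∣ X ∣ ⇔ k i ≤ ∣ X ∣
      K⇔k {X} X-tight = mk⇔ (to k-wins ∘ to (same X) ∘ from K-wins) (to K-wins ∘ from (same X) ∘ from k-wins)
        where
        K-wins : DHWin part K X ⇔ K i ≤ ∣ X ∣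
        K-wins = Tight⇒wins⇔ K-thr agree X-tight
        k-wins : DHWin part k X ⇔ k i ≤ ∣ X ∣
        k-wins = Tight⇒wins⇔ k-thr (λ _ _ → refl) X-tight
      K≤k : K i ≤ k i
      K≤k with X , X-tight , ∣X∣≡k ← tight-of-size effective-below (<⇒≤ (base<k i)) (effective i ≤-refl) =
        subst (K i ≤_) ∣X∣≡k (from (K⇔k X-tight) (≤-reflexive (sym ∣X∣≡k)))
      k≤K : k i ≤ K i
      k≤K with ≤-total (k i) (K i)
      ... | inj₁ k≤K = k≤K
      ... | inj₂ K≤k
        with X , X-tight , ∣X∣≡K ← tight-of-size effective-below (base≤K K-thr agree)
                                     (≤-trans K≤k (effective i ≤-refl)) =
        subst (k i ≤_) ∣X∣≡K (to (K⇔k X-tight) (≤-reflexive (sym ∣X∣≡K)))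

    thresholds-agree : ∀ {K} → Thresholds K → SameGame K → ∀ i → EffectiveUpTo i → K i ≡ k i
    thresholds-agree {K} K-thr same = All.wfRec <-wellFounded 0ℓ P step
      where
      P : Pred (Fin (suc M)) 0ℓ
      P i = EffectiveUpTo i → K i ≡ k i
      step : ∀ i → WfRec Fin._<_ P i → P i
      step i IH effective = threshold-agrees K-thr same effective
        λ j j<i → IH j<i λ l l≤j → effective l (≤-trans l≤j (<⇒≤ j<i))

    opaque
      separating-coalition : ∀ p q → part p Fin.< part q → EffectiveUpTo (part p) →
        ∃ λ X → p ∉ X × q ∉ X × DHWin part k (X ∪ ⁅ p ⁆) × ¬ DHWin part k (X ∪ ⁅ q ⁆)
      separating-coalition p q p<q effective
        with X , X-tight@(X⊆U , _) , p∉X , suc∣X∣≡k ← tight-avoiding p effective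
        = X , p∉X , q∉X , X∪p-wins , X∪q-loses
        where
        q∉X : q ∉ X
        q∉X q∈X = <⇒≱ p<q (to ∈U⇔ (X⊆U q∈X))
        X∪p-wins : DHWin part k (X ∪ ⁅ p ⁆)
        X∪p-wins = from (Tight⇒wins⇔ k-thr (λ _ _ → refl) (Tight∪Level⇒Tight X-tight refl))
          (≤-reflexive (trans (sym suc∣X∣≡k) (sym (x∉p⇒∣p∪⁅x⁆∣≡suc∣p∣ p∉X))))
        X∪q-loses : ¬ DHWin part k (X ∪ ⁅ q ⁆)
        X∪q-loses X∪q-wins = <⇒≱ (proj₂ k-thr _ _ p<q) (begin
          k (part q)      ≤⟨ Short⇒wins⇒K≤∣Y∣ k-thr {part q} {X ∪ ⁅ q ⁆} X∪q-short X∪q-wins ⟩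
          ∣ X ∪ ⁅ q ⁆ ∣   ≡⟨ x∉p⇒∣p∪⁅x⁆∣≡suc∣p∣ q∉X ⟩
          suc ∣ X ∣       ≡⟨ suc∣X∣≡k ⟩
          k (part p)      ∎)
          where
          open ≤-Reasoning
          X∪q-short : Short k (part q) (X ∪ ⁅ q ⁆)
          X∪q-short j j<q = subst (_< k j) (cong ∣_∣ (sym (x∉q⇒[p∪⁅x⁆]∩q≡p∩q X (U j) q q∉Uⱼ)))
            (Tight∧∣X∣<k⇒∣X∩U∣<k X-tight (≤-reflexive suc∣X∣≡k) j)
            where
            q∉Uⱼ : q ∉ U j
            q∉Uⱼ q∈U = <⇒≱ j<q (to ∈U⇔ q∈U)

    not-dummy : ∀ p → EffectiveUpTo (part p) → ¬ Dummy (DHWin part k) p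
    not-dummy p effective dummy
      with X , X-tight , p∉X , suc∣X∣≡k ← tight-avoiding p effective
      = dummy (X ∪ ⁅ p ⁆)
          (Tight⇒minimal (Tight∪Level⇒Tight X-tight refl)
            (trans (x∉p⇒∣p∪⁅x⁆∣≡suc∣p∣ p∉X) suc∣X∣≡k))
          (x∈p∪q⁺ (inj₂ (x∈⁅x⁆ p)))

    ¬Effective⇒redundant : ∀ {j Y} → ¬ Effective j → k j ≤ ∣ Y ∩ U j ∣ → ∃ λ l → l Fin.< j × k l ≤ ∣ Y ∩ U l ∣
    ¬Effective⇒redundant {Fin.zero} {Y} ineffective k≤ = contradiction (begin
      k Fin.zero           ≤⟨ k≤ ⟩
      ∣ Y ∩ U Fin.zero ∣   ≤⟨ ∣p∩q∣≤∣q∣ Y (U Fin.zero) ⟩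
      ∣ U Fin.zero ∣       ≤⟨ p⊆q⇒∣p∣≤∣q∣ U-zero⊆L-zero ⟩
      n Fin.zero           ∎) ineffective
      where open ≤-Reasoning
    ¬Effective⇒redundant {Fin.suc i} {Y} ineffective k≤ = inject₁ i , inject₁<suc i ,
      subst (_≤ ∣ Y ∩ U (inject₁ i) ∣) (suc-pred-k (inject₁ i)) (+-cancelʳ-< (n (Fin.suc i)) _ _ (begin-strict
        ℕ.pred (k (inject₁ i)) + n (Fin.suc i)   <⟨ ≰⇒> ineffective ⟩
        k (Fin.suc i)                           ≤⟨ k≤ ⟩
        ∣ Y ∩ U (Fin.suc i) ∣                   ≤⟨ ∣X∩U-suc∣≤∣X∩U-inject₁∣+n-suc Y i ⟩
        ∣ Y ∩ U (inject₁ i) ∣ + n (Fin.suc i)   ∎))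
      where open ≤-Reasoning

    ¬Effective⇒wins-elsewhere : ∀ {j Y} → ¬ Effective j → DHWin part k Y → ∃ λ l → l ≢ j × k l ≤ ∣ Y ∩ U l ∣
    ¬Effective⇒wins-elsewhere {j} {Y} ineffective (l , k≤) with l Fin.≟ j
    ... | no l≢j = l , l≢j , k≤
    ... | yes refl with l′ , l′<l , k≤′ ← ¬Effective⇒redundant {l} {Y} ineffective k≤ =
      l′ , (λ l′≡l → <-irrefl (cong toℕ l′≡l) l′<l) , k≤′

    ¬Effective⇒Equiv-next : ∀ {j p q} → ¬ Effective j → part p ≡ j → toℕ (part q) ≡ suc (toℕ j) →
      Equiv (DHWin part k) p q
    ¬Effective⇒Equiv-next {j} {p} {q} ineffective p∈Lⱼ q∈Lⱼ₊₁ X p∉X q∉X =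
      mk⇔ p⇒q (lower-dominates k p≤q p∉X q∉X)
      where
      p≤q : part p Fin.≤ part q
      p≤q = ≤-trans (≤-reflexive (cong toℕ p∈Lⱼ)) (subst (toℕ j ≤_) (sym q∈Lⱼ₊₁) (n≤1+n (toℕ j)))
      p⇒q : DHWin part k (X ∪ ⁅ p ⁆) → DHWin part k (X ∪ ⁅ q ⁆)
      p⇒q X∪p-wins
        with l , l≢j , k≤ ← ¬Effective⇒wins-elsewhere {j} {X ∪ ⁅ p ⁆} ineffective X∪p-wins
        with <-cmp (toℕ l) (toℕ j)
      ... | tri≈ _ l≡j _ = contradiction (toℕ-injective l≡j) l≢j
      ... | tri< l<j _ _ = l , (begin
        k l                      ≤⟨ k≤ ⟩
        ∣ (X ∪ ⁅ p ⁆) ∩ U l ∣    ≡⟨ cong ∣_∣ (x∉q⇒[p∪⁅x⁆]∩q≡p∩q X (U l) p p∉Uₗ) ⟩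
        ∣ X ∩ U l ∣              ≤⟨ p⊆q⇒∣p∩r∣≤∣q∩r∣ (p⊆p∪q {p = X} ⁅ q ⁆) (U l) ⟩
        ∣ (X ∪ ⁅ q ⁆) ∩ U l ∣    ∎)
        where
        open ≤-Reasoning
        p∉Uₗ : p ∉ U l
        p∉Uₗ p∈U = <⇒≱ l<j (subst (_≤ toℕ l) (cong toℕ p∈Lⱼ) (to ∈U⇔ p∈U))
      ... | tri> _ _ j<l = l , (begin
        k l                      ≤⟨ k≤ ⟩
        ∣ (X ∪ ⁅ p ⁆) ∩ U l ∣    ≤⟨ ∣[p∪⁅x⁆]∩q∣≤suc∣p∩q∣ X (U l) p ⟩
        suc ∣ X ∩ U l ∣          ≡⟨ x∉p∧x∈q⇒∣[p∪⁅x⁆]∩q∣≡suc∣p∩q∣ X (U l) q q∉X q∈Uₗ ⟨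
        ∣ (X ∪ ⁅ q ⁆) ∩ U l ∣    ∎)
        where
        open ≤-Reasoning
        q∈Uₗ : q ∈ U l
        q∈Uₗ = from ∈U⇔ (subst (_≤ toℕ l) (sym q∈Lⱼ₊₁) j<l)

    ¬Effective⇒top-dummy : ∀ {j p} → ¬ Effective j → (∀ l → l Fin.≤ j) → part p ≡ j → Dummy (DHWin part k) p
    ¬Effective⇒top-dummy {j} {p} ineffective top p∈Lⱼ X (X-wins , X-minimal) p∈X
      with l , l≢j , k≤ ← ¬Effective⇒wins-elsewhere {j} {X} ineffective X-wins
      = x∉p-x X p (X-minimal (X - p) (p─q⊆p X ⁅ p ⁆) X-p-wins p∈X)
      where
      p∉Uₗ : p ∉ U l
      p∉Uₗ p∈U = l≢j (toℕ-injective (≤-antisym (top l) (subst (_≤ toℕ l) (cong toℕ p∈Lⱼ) (to ∈U⇔ p∈U))))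
      X-p-wins : DHWin part k (X - p)
      X-p-wins = l , ≤-trans k≤ (p⊆q⇒∣p∣≤∣q∣ (x∉q⇒p∩q⊆[p-x]∩q X (U l) p p∉Uₗ))

module _ {N m₀ : ℕ} (part : Fin N → Fin (suc (suc m₀)))
         (k : Fin (suc (suc m₀)) → ℕ) (k-thr : Thresholds k) where

  open Tiers part
  open Game k k-thr

  EffectiveBelowTop : Set
  EffectiveBelowTop = ∀ j → toℕ j ≤ m₀ → Effective j

  conditions⇔EffectiveBelowTop : (CondA part k × CondB part k) ⇔ EffectiveBelowTop
  conditions⇔EffectiveBelowTop = mk⇔ (λ (A , B) → effective A B) conditions
    where
    effective : CondA part k → CondB part k → EffectiveBelowTop
    effective A B Fin.zero _ = A
    effective A B (Fin.suc j) j≤m₀ =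
      from (Effective-suc⇔ j) (B (inject₁ j) (Fin.suc j) (cong suc (sym (toℕ-inject₁ j))) (s≤s (s≤s j≤m₀)))
    conditions : EffectiveBelowTop → CondA part k × CondB part k
    conditions effective = effective Fin.zero z≤n , condB
      where
      condB : CondB part k
      condB i (Fin.suc j) 1+j≡1+i 2+j<2+m₀
        rewrite toℕ-injective {i = i} {inject₁ j} (trans (sym (suc-injective 1+j≡1+i)) (sym (toℕ-inject₁ j)))
        = to (Effective-suc⇔ j) (effective (Fin.suc j) (ℕ.s≤s⁻¹ (ℕ.s≤s⁻¹ 2+j<2+m₀)))

  effective-everywhere : EffectiveBelowTop → Effective (lastL m₀) → ∀ j → Effective j
  effective-everywhere effective effective-last j with toℕ j ℕ.≤? m₀
  ... | yes j≤m₀ = effective j j≤m₀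
  ... | no j≰m₀ = subst Effective (sym j≡top) effective-last
    where
    j≡top : j ≡ lastL m₀
    j≡top = toℕ-injective (≤-antisym (≤fromℕ j) (subst (_≤ toℕ j) (sym (toℕ-fromℕ (suc m₀))) (≰⇒> j≰m₀)))

  module _ (part-onto : ∀ i → ∃ λ p → part p ≡ i) where

    classes⇒EffectiveBelowTop : HasExactlyClasses (Equiv (DHWin part k)) (suc (suc m₀)) → EffectiveBelowTop
    classes⇒EffectiveBelowTop classes j j≤m₀ with k j ℕ.≤? base j + n j
    ... | yes effective = effective
    ... | no ineffective =
      contradiction (trans (sym q∈Lⱼ₊₁) (trans (cong toℕ (sym p≡q)) (cong toℕ p∈Lⱼ))) 1+n≢n
      where
      p q : Fin N
      p = proj₁ (part-onto j)
      q = proj₁ (part-onto (Fin.fromℕ< (s≤s (s≤s j≤m₀))))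
      p∈Lⱼ : part p ≡ j
      p∈Lⱼ = proj₂ (part-onto j)
      q∈Lⱼ₊₁ : toℕ (part q) ≡ suc (toℕ j)
      q∈Lⱼ₊₁ = trans (cong toℕ (proj₂ (part-onto _))) (toℕ-fromℕ< (s≤s (s≤s j≤m₀)))
      p≡q : part p ≡ part q
      p≡q = level-classes-separate {W = DHWin part k} part part-onto (same-level⇒Equiv k) classes
              (¬Effective⇒Equiv-next {j} ineffective p∈Lⱼ q∈Lⱼ₊₁)

    EffectiveBelowTop⇒classes : EffectiveBelowTop → HasExactlyClasses (Equiv (DHWin part k)) (suc (suc m₀))
    EffectiveBelowTop⇒classes effective =
      part , part-onto , λ p q → mk⇔ (Equiv⇒same-level p q) (same-level⇒Equiv k)
      where
      effective-up-to : ∀ {p} q → part p Fin.< part q → EffectiveUpTo (part p)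
      effective-up-to q p<q j j≤p =
        effective j (ℕ.s≤s⁻¹ (≤-trans (≤-<-trans j≤p p<q) (ℕ.s≤s⁻¹ (toℕ<n (part q)))))
      Equiv⇒same-level : ∀ p q → Equiv (DHWin part k) p q → part p ≡ part q
      Equiv⇒same-level p q p∼q with <-cmp (toℕ (part p)) (toℕ (part q))
      ... | tri≈ _ p≡q _ = toℕ-injective p≡q
      ... | tri< p<q _ _
        with X , p∉X , q∉X , X∪p-wins , X∪q-loses ← separating-coalition p q p<q (effective-up-to q p<q)
        = contradiction (to (p∼q X p∉X q∉X) X∪p-wins) X∪q-loses
      ... | tri> _ _ q<p
        with X , q∉X , p∉X , X∪q-wins , X∪p-loses ← separating-coalition q p q<p (effective-up-to p q<p)
        = contradiction (from (p∼q X p∉X q∉X) X∪q-wins) X∪p-loses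

    no-dummy⇔Effective-top : EffectiveBelowTop → (∀ p → ¬ Dummy (DHWin part k) p) ⇔ Effective (lastL m₀)
    no-dummy⇔Effective-top effective = mk⇔ top-effective
      (λ effective-top p → not-dummy p λ j _ → effective-everywhere effective effective-top j)
      where
      top-effective : (∀ p → ¬ Dummy (DHWin part k) p) → Effective (lastL m₀)
      top-effective no-dummy with k (lastL m₀) ℕ.≤? base (lastL m₀) + n (lastL m₀)
      ... | yes effective-top = effective-top
      ... | no ineffective = contradiction
        (¬Effective⇒top-dummy {lastL m₀} ineffective ≤fromℕ (proj₂ (part-onto (lastL m₀)))) (no-dummy _)

theorem3 : (N m₀ : ℕ) (part : Fin N → Fin (suc (suc m₀)))
    → ((i : Fin (suc (suc m₀))) → ∃ λ p → part p ≡ i)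
    → (k : Fin (suc (suc m₀)) → ℕ) → Thresholds k
    → (HasExactlyClasses (Equiv (DHWin part k)) (suc (suc m₀))
         ⇔ (CondA part k × CondB part k))
      × (CondA part k × CondB part k
         → ((k′ : Fin (suc (suc m₀)) → ℕ) → Thresholds k′
              → ((X : Subset N) → DHWin part k′ X ⇔ DHWin part k X)
              → (i : Fin (suc (suc m₀))) → suc (toℕ i) < suc (suc m₀) → k′ i ≡ k i)
           × (((p : Fin N) → ¬ Dummy (DHWin part k) p)
                ⇔ (k (lastL m₀) < k (penL m₀) + size part (lastL m₀)))
           × (k (lastL m₀) < k (penL m₀) + size part (lastL m₀)
                → (k′ : Fin (suc (suc m₀)) → ℕ) → Thresholds k′
                → ((X : Subset N) → DHWin part k′ X ⇔ DHWin part k X)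
                → k′ (lastL m₀) ≡ k (lastL m₀))
           × (k (penL m₀) + size part (lastL m₀) ≤ k (lastL m₀)
                → (p : Fin N) → part p ≡ lastL m₀ → Dummy (DHWin part k) p))
theorem3 N m₀ part part-onto k k-thr =
  mk⇔ (from conditions⇔ ∘ classes⇒EffectiveBelowTop part k k-thr part-onto)
      (EffectiveBelowTop⇒classes part k k-thr part-onto ∘ to conditions⇔) ,
  λ conditions → let effective = to conditions⇔ conditions in
    (λ k′ k′-thr same i 2+i≤2+m₀ → thresholds-agree k′-thr same i
       λ j j≤i → effective j (≤-trans j≤i (ℕ.s≤s⁻¹ (ℕ.s≤s⁻¹ 2+i≤2+m₀)))) ,
    ⇔.trans (no-dummy⇔Effective-top part k k-thr part-onto effective) top⇔ ,
    (λ k< k′ k′-thr same → thresholds-agree k′-thr same (lastL m₀)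
       λ j _ → effective-everywhere part k k-thr effective (from top⇔ k<) j) ,
    λ k≥ p p∈top → ¬Effective⇒top-dummy {lastL m₀} (≤⇒≯ k≥ ∘ to top⇔) ≤fromℕ p∈top
  where
  open Tiers part
  open Game k k-thr
  conditions⇔ : (CondA part k × CondB part k) ⇔ EffectiveBelowTop part k k-thr
  conditions⇔ = conditions⇔EffectiveBelowTop part k k-thr
  top⇔ : Effective (lastL m₀) ⇔ k (lastL m₀) < k (penL m₀) + size part (lastL m₀)
  top⇔ = Effective-suc⇔ (Fin.fromℕ m₀)
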